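{- For every finite hypergraph $H$, $\mathrm{ch}_{\mathrm{um}}(H)\le s(H)$.
   Context: $s(H)$ is the minimum positive integer $s$ such that the number of hyperedges of $H$ is at most $s(s-1)/2$. A unique-maximum coloring of $H=(V,\mathcal{E})$ is a coloring $C\colon V\to\mathbb{Z}_{>0}$ such that in every hyperedge the maximum color occurs on exactly one vertex. $\mathrm{ch}_{\mathrm{um}}(H)$ is the minimum $k$ such that for every family $\{L_v\}_{v\in V}$ of sets of positive integers with $|L_v|\ge k$ there is a unique-maximum coloring with $C(v)\in L_v$ for all $v$. -}

module Defs where

open import Data.Nat using (ℕ; zero; suc; _*_; _∸_; _≤_; _<_)
open import Data.Fin using (Fin)
open import Data.Fin.Subset using (Subset; _∈_; Nonempty)
open import Data.List using (List; length)
open import Data.List.Relation.Unary.All using (All)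
open import Data.List.Relation.Unary.Unique.Propositional using (Unique)
import Data.List.Membership.Propositional as LM
open import Data.Sum using (_⊎_)
open import Data.Product using (Σ; ∃; _×_; ∃-syntax)
open import Relation.Binary.PropositionalEquality using (_≡_)

record Hypergraph : Set where
  field
    n        : ℕ
    edges    : List (Subset n)
    distinct : Unique edges
    nonempty : All Nonempty edges
open Hypergraph public

∣E∣ : Hypergraph → ℕ
∣E∣ H = length (edges H)

-- s is s(H): the minimum positive integer s with |E| ≤ s(s-1)/2
-- (written as 2|E| ≤ s(s-1) to avoid division).
IsS : Hypergraph → ℕ → Set
IsS H s = 1 ≤ s × 2 * ∣E∣ H ≤ s * (s ∸ 1)
        × (∀ t → 1 ≤ t → 2 * ∣E∣ H ≤ t * (t ∸ 1) → s ≤ t)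

UniqueMaxIn : ∀ {n} → (Fin n → ℕ) → Subset n → Set
UniqueMaxIn {n} C e =
  ∃[ v ] (v ∈ e × (∀ w → w ∈ e → w ≡ v ⊎ C w < C v))

IsUMColoring : (H : Hypergraph) → (Fin (n H) → ℕ) → Set
IsUMColoring H C = (∀ v → 1 ≤ C v) × All (UniqueMaxIn C) (edges H)

IsListAssignment : (H : Hypergraph) → ℕ → (Fin (n H) → List ℕ) → Set
IsListAssignment H k L =
  ∀ v → Unique (L v) × All (1 ≤_) (L v) × k ≤ length (L v)

UMChoosable : Hypergraph → ℕ → Set
UMChoosable H k = ∀ (L : Fin (n H) → List ℕ) → IsListAssignment H k L →
  Σ (Fin (n H) → ℕ) λ C → IsUMColoring H C × (∀ v → C v LM.∈ L v)

-- ch_um(H) ≤ s : the minimum k such that H is UM k-choosable is at most s,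
-- i.e. some k ≤ s works.
ChUmAtMost : Hypergraph → ℕ → Set
ChUmAtMost H s = ∃[ k ] (k ≤ s × UMChoosable H k)

-- Induction on the support of the hypergraph, allowing empty and repeated edges.
-- Let v be a vertex of the support whose list contains the largest colour M.
-- If v lies in fewer than s edges, colour the hypergraph with v deleted from every
-- edge; each edge through v then forbids one colour for v (the colour of its
-- unique maximum), so some colour of the s-element list of v is still free.
-- Otherwise give v the colour M, which is then the unique maximum of every edge
-- through v, delete those edges and remove M from every list: at most
-- s(s-1)/2 - s ≤ (s-1)(s-2)/2 edges remain, to be coloured from lists of size s - 1.
module Submission where

open import Defs
open import Data.Nat using (ℕ; suc; _+_; _*_; _∸_; _≤_; _<_; z≤n; s≤s; _≟_; _<?_)
open import Data.Nat.Properties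
open import Data.Nat.Induction using (<-wellFounded)
open import Data.Nat.Tactic.RingSolver using (solve-∀)
open import Data.Fin using (Fin; zero; suc)
open import Data.Fin.Properties using () renaming (_≟_ to _≟ᶠ_)
open import Data.Fin.Subset
  using (Subset; outside; inside; ⁅_⁆; _∈_; _∉_; _⊆_; _⊂_; _-_; ⋃; ∣_∣; Nonempty)
open import Data.Fin.Subset.Properties
  using ( _∈?_; nonempty?; ∉⊥; x∈p∪q⁺; x∈p∪q⁻; p─q⊆p; p─⊥≡p; x∈p∧x≢y⇒x∈p-y
        ; p⊂q⇒∣p∣<∣q∣)
open import Data.Vec as Vec using (_∷_)
open import Data.Vec.Functional using (updateAt)
open import Data.Vec.Functional.Properties using (updateAt-updates; updateAt-minimal)
open import Data.List using (List; []; _∷_; length; map; filter; allFin)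
open import Data.List.Properties
  using (length-map; length-removeAt′; filter-all; filter-accept; filter-reject)
open import Data.List.Relation.Unary.Any as Any using (here; there)
open import Data.List.Relation.Unary.All as All using (All; []; _∷_; all?)
open import Data.List.Relation.Unary.All.Properties
  using (map⁺; all-filter; filter⁻; ¬All⇒Any¬)
open import Data.List.Relation.Unary.AllPairs using ([]; _∷_)
open import Data.List.Relation.Unary.Unique.Propositional using (Unique)
import Data.List.Relation.Unary.Unique.Propositional.Properties as Unique
open import Data.List.Membership.Propositional
  using (find) renaming (_∈_ to _∈ˡ_; _∉_ to _∉ˡ_)
open import Data.List.Membership.Propositional.Properties
  using (∈-filter⁺; ∈-filter⁻; ∈-allFin)
open import Data.List.Membership.DecPropositional _≟_ using () renaming (_∈?_ to _∈ˡ?_)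
open import Data.List.Extrema.Nat
  using (max; argmax; argmax-sel; argmax-all; xs≤max; f[xs]≤f[argmax])
open import Data.Bool using (true; false)
open import Data.Sum using (inj₁; inj₂) renaming (map₂ to ⊎-map₂)
open import Data.Product using (∃-syntax; _×_; _,_; proj₁; proj₂)
open import Function using (_∘_; const)
open import Induction.WellFounded using (Acc; acc)
open import Relation.Nullary using (yes; no; does; ¬?; contradiction)
open import Relation.Nullary.Decidable using (toSum)
open import Relation.Unary using (Pred; Decidable)
open import Relation.Binary.PropositionalEquality

private
  variable
    m : ℕ

x∉p-x : ∀ (x : Fin m) p → x ∉ p - x
x∉p-x zero    (_ ∷ p) ()
x∉p-x (suc x) (_ ∷ p) (Vec.there x∈) = x∉p-x x p x∈

x∉p⇒p-x≡p : ∀ {x : Fin m} {p} → x ∉ p → p - x ≡ p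
x∉p⇒p-x≡p {x = zero}  {outside ∷ p} _   = cong (outside ∷_) (p─⊥≡p p)
x∉p⇒p-x≡p {x = zero}  {inside ∷ p}  x∉p = contradiction Vec.here x∉p
x∉p⇒p-x≡p {x = suc x} {s ∷ p}       x∉p = cong (s ∷_) (x∉p⇒p-x≡p (x∉p ∘ Vec.there))

p⊆⋃ : ∀ {p : Subset m} {ps} → p ∈ˡ ps → p ⊆ ⋃ ps
p⊆⋃ (here refl)  x∈p = x∈p∪q⁺ (inj₁ x∈p)
p⊆⋃ (there p∈ps) x∈p = x∈p∪q⁺ (inj₂ (p⊆⋃ p∈ps x∈p))

x∈⋃⁻ : ∀ {x : Fin m} ps → x ∈ ⋃ ps → ∃[ p ] p ∈ˡ ps × x ∈ p
x∈⋃⁻ []       x∈⊥ = contradiction x∈⊥ ∉⊥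
x∈⋃⁻ (p ∷ ps) x∈  with x∈p∪q⁻ p (⋃ ps) x∈
... | inj₁ x∈p = p , here refl , x∈p
... | inj₂ x∈⋃ with x∈⋃⁻ ps x∈⋃
...   | q , q∈ps , x∈q = q , there q∈ps , x∈q

⋃-⊂ : ∀ {ps qs : List (Subset m)} {x} → x ∈ ⋃ ps →
      All (λ q → q ⊆ ⋃ ps × x ∉ q) qs → ⋃ qs ⊂ ⋃ ps
⋃-⊂ {ps = ps} {qs} {x} x∈⋃ps qs⊆ = ⋃qs⊆⋃ps , x , x∈⋃ps , x∉⋃qs
  where
  ⋃qs⊆⋃ps : ⋃ qs ⊆ ⋃ ps
  ⋃qs⊆⋃ps y∈ with x∈⋃⁻ qs y∈
  ... | q , q∈qs , y∈q = proj₁ (All.lookup qs⊆ q∈qs) y∈q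

  x∉⋃qs : x ∉ ⋃ qs
  x∉⋃qs x∈ with x∈⋃⁻ qs x∈
  ... | q , q∈qs , x∈q = proj₂ (All.lookup qs⊆ q∈qs) x∈q

maximiser : ∀ (g : Fin m → ℕ) p → Nonempty p →
            ∃[ v ] v ∈ p × (∀ {w} → w ∈ p → g w ≤ g v)
maximiser g p (v₀ , v₀∈p) =
  argmax g v₀ ws ,
  argmax-all g v₀∈p (all-filter (_∈? p) (allFin _)) ,
  λ w∈p → All.lookup (f[xs]≤f[argmax] v₀ ws) (∈-filter⁺ (_∈? p) (∈-allFin _) w∈p)
  where
  ws = filter (_∈? p) (allFin _)

top : List ℕ → ℕ
top = max 0

≤-top : ∀ {c xs} → c ∈ˡ xs → c ≤ top xs
≤-top {xs = xs} = All.lookup (xs≤max 0 xs)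

top-∈ : ∀ {xs} → 0 < length xs → top xs ∈ˡ xs
top-∈ {x ∷ xs} _ with argmax-sel (λ c → c) 0 (x ∷ xs)
... | inj₂ top∈  = top∈
... | inj₁ top≡0 = here (trans top≡0 (sym (n≤0⇒n≡0 x≤0)))
  where
  x≤0 : x ≤ 0
  x≤0 = subst (x ≤_) top≡0 (≤-top {xs = x ∷ xs} (here refl))

length-filter-¬ : ∀ {a p} {A : Set a} {P : Pred A p} (P? : Decidable P) xs →
                  length (filter P? xs) + length (filter (¬? ∘ P?) xs) ≡ length xs
length-filter-¬ P? []       = refl
length-filter-¬ P? (x ∷ xs) with does (P? x)
... | true  = cong suc (length-filter-¬ P? xs)
... | false = trans (+-suc _ _) (cong suc (length-filter-¬ P? xs))

without : ℕ → List ℕ → List ℕ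
without x = filter (λ y → ¬? (y ≟ x))

∈-without⁻ : ∀ {x c xs} → c ∈ˡ without x xs → c ∈ˡ xs × c ≢ x
∈-without⁻ {x} {xs = xs} = ∈-filter⁻ (λ y → ¬? (y ≟ x)) {xs = xs}

length-without : ∀ x {xs} → Unique xs → length xs ≤ suc (length (without x xs))
length-without x {[]}     []         = z≤n
length-without x {y ∷ ys} (y∉ys ∷ u) with y ≟ x
... | yes refl = ≤-reflexive (cong suc (sym (begin
  length (without y (y ∷ ys)) ≡⟨ cong length (filter-reject (λ z → ¬? (z ≟ y)) (λ y≢y → y≢y refl)) ⟩
  length (without y ys)       ≡⟨ cong length (filter-all (λ z → ¬? (z ≟ y)) ys≢y) ⟩
  length ys                   ∎)))
  where
  open ≡-Reasoning
  ys≢y : All (_≢ y) ys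
  ys≢y = All.map (λ y≢z z≡y → y≢z (sym z≡y)) y∉ys
... | no y≢x   = subst (suc (length ys) ≤_)
                   (cong (suc ∘ length) (sym (filter-accept (λ z → ¬? (z ≟ x)) y≢x)))
                   (s≤s (length-without x u))

∈-─ : ∀ {x c : ℕ} {xs} (x∈xs : x ∈ˡ xs) → c ∈ˡ xs → c ≢ x → c ∈ˡ (xs Any.─ x∈xs)
∈-─ (here refl) (here refl) c≢x = contradiction refl c≢x
∈-─ (here refl) (there c∈)  _   = c∈
∈-─ (there x∈)  (here c≡)   _   = here c≡
∈-─ (there x∈)  (there c∈)  c≢x = there (∈-─ x∈ c∈ c≢x)

Unique-⊆⇒length≤ : ∀ {xs ys : List ℕ} → Unique xs → All (_∈ˡ ys) xs → length xs ≤ length ys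
Unique-⊆⇒length≤               []         []             = z≤n
Unique-⊆⇒length≤ {ys = ys} (x∉xs ∷ u) (x∈ys ∷ xs⊆ys) =
  subst (suc _ ≤_) (sym (length-removeAt′ ys (Any.index x∈ys)))
    (s≤s (Unique-⊆⇒length≤ u (All.zipWith move (x∉xs , xs⊆ys))))
  where
  move : ∀ {c} → _ ≢ c × c ∈ˡ ys → c ∈ˡ (ys Any.─ x∈ys)
  move (x≢c , c∈ys) = ∈-─ x∈ys c∈ys (x≢c ∘ sym)

∃-∉ : ∀ {xs ys : List ℕ} → Unique xs → length ys < length xs → ∃[ c ] c ∈ˡ xs × c ∉ˡ ys
∃-∉ {xs} {ys} u ys<xs with all? (_∈ˡ? ys) xs
... | yes xs⊆ys = contradiction (Unique-⊆⇒length≤ u xs⊆ys) (<⇒≱ ys<xs)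
... | no ¬xs⊆ys = find (¬All⇒Any¬ (_∈ˡ? ys) xs ¬xs⊆ys)

UniqueMaxOn : (Fin m → ℕ) → List (Subset m) → Set
UniqueMaxOn C = All (λ e → Nonempty e → UniqueMaxIn C e)

ChosenFrom : (Fin m → List ℕ) → (Fin m → ℕ) → Set
ChosenFrom L C = ∀ w → C w ∈ˡ L w

DistinctOfLength≥ : ℕ → (Fin m → List ℕ) → Set
DistinctOfLength≥ s L = ∀ w → Unique (L w) × s ≤ length (L w)

degree : Fin m → List (Subset m) → ℕ
degree v E = length (filter (v ∈?_) E)

avoiding : Fin m → List (Subset m) → List (Subset m)
avoiding v = filter (¬? ∘ (v ∈?_))

_[_↦_] : (Fin m → ℕ) → Fin m → ℕ → Fin m → ℕ
C [ v ↦ c ] = updateAt C v (const c)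

↦-chosen : ∀ {L : Fin m → List ℕ} {C v c} →
           ChosenFrom L C → c ∈ˡ L v → ChosenFrom L (C [ v ↦ c ])
↦-chosen {C = C} {v} C∈L c∈Lv w with w ≟ᶠ v
... | yes refl = subst (_∈ˡ _) (sym (updateAt-updates v C)) c∈Lv
... | no w≢v   = subst (_∈ˡ _) (sym (updateAt-minimal w v C w≢v)) (C∈L w)

UniqueMaxIn-cong : ∀ {C C′ : Fin m → ℕ} {e} → (∀ {w} → w ∈ e → C w ≡ C′ w) →
                   UniqueMaxIn C e → UniqueMaxIn C′ e
UniqueMaxIn-cong C≡C′ (u , u∈e , max) =
  u , u∈e , λ w w∈e → ⊎-map₂ (subst₂ _<_ (C≡C′ w∈e) (C≡C′ u∈e)) (max w w∈e)

UniqueMaxIn-at : ∀ {C : Fin m → ℕ} {e v} → v ∈ e →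
                 (∀ {w} → w ∈ e → w ≢ v → C w < C v) → UniqueMaxIn C e
UniqueMaxIn-at {v = v} v∈e below =
  v , v∈e , λ w w∈e → ⊎-map₂ (below w∈e) (toSum (w ≟ᶠ v))

one-forbidden-colour : ∀ (C : Fin m → ℕ) {v e} → v ∈ e →
                       (Nonempty (e - v) → UniqueMaxIn C (e - v)) →
                       ∃[ f ] ∀ c → c ≢ f → UniqueMaxIn (C [ v ↦ c ]) e
one-forbidden-colour C {v} {e} v∈e um with nonempty? (e - v)
... | no e-v≡∅ = 0 , λ c _ → UniqueMaxIn-at v∈e λ w∈e w≢v →
  contradiction (_ , x∈p∧x≢y⇒x∈p-y w∈e w≢v) e-v≡∅
... | yes e-v≢∅ with um e-v≢∅
... | u , u∈e-v , u-max = C u , colour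
  where
  u≢v : u ≢ v
  u≢v refl = x∉p-x v e u∈e-v

  elsewhere : ∀ {c w} → w ≢ v → (C [ v ↦ c ]) w ≡ C w
  elsewhere w≢v = updateAt-minimal _ v C w≢v

  ≤-u : ∀ {w} → w ∈ e → w ≢ v → C w ≤ C u
  ≤-u w∈e w≢v with u-max _ (x∈p∧x≢y⇒x∈p-y w∈e w≢v)
  ... | inj₁ refl = ≤-refl
  ... | inj₂ w<u  = <⇒≤ w<u

  colour : ∀ c → c ≢ C u → UniqueMaxIn (C [ v ↦ c ]) e
  colour c c≢u with c <? C u
  ... | yes c<u = UniqueMaxIn-at (p─q⊆p _ _ u∈e-v) below-u
    where
    below-u : ∀ {w} → w ∈ e → w ≢ u → (C [ v ↦ c ]) w < (C [ v ↦ c ]) u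
    below-u {w} w∈e w≢u rewrite elsewhere {c} u≢v with w ≟ᶠ v
    ... | yes refl = subst (_< C u) (sym (updateAt-updates v C)) c<u
    ... | no w≢v with u-max w (x∈p∧x≢y⇒x∈p-y w∈e w≢v)
    ...   | inj₁ w≡u = contradiction w≡u w≢u
    ...   | inj₂ w<u = subst (_< C u) (sym (elsewhere w≢v)) w<u
  ... | no c≮u = UniqueMaxIn-at v∈e λ w∈e w≢v →
    subst₂ _<_ (sym (elsewhere w≢v)) (sym (updateAt-updates v C))
      (≤-<-trans (≤-u w∈e w≢v) (≤∧≢⇒< (≮⇒≥ c≮u) (c≢u ∘ sym)))

forbidden-colours : ∀ (C : Fin m → ℕ) v E → UniqueMaxOn C (map (_- v) E) →
                    ∃[ F ] length F ≡ degree v E ×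
                           (∀ c → c ∉ˡ F → UniqueMaxOn (C [ v ↦ c ]) E)
forbidden-colours C v []       []         = [] , refl , λ _ _ → []
forbidden-colours C v (e ∷ E) (um ∷ ums) with forbidden-colours C v E ums | v ∈? e
... | F , |F| , F-free | yes v∈e with one-forbidden-colour C v∈e um
...   | f , f-free =
  f ∷ F , cong suc |F| , λ c c∉ → (λ _ → f-free c (c∉ ∘ here)) ∷ F-free c (c∉ ∘ there)
forbidden-colours C v (e ∷ E) (um ∷ ums) | F , |F| , F-free | no v∉e =
  F , |F| , λ c c∉F → (λ e≢∅ → UniqueMaxIn-cong (away c) (um′ e≢∅)) ∷ F-free c c∉F
  where
  um′ : Nonempty e → UniqueMaxIn C e
  um′ = subst (λ e′ → Nonempty e′ → UniqueMaxIn C e′) (x∉p⇒p-x≡p v∉e) um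

  away : ∀ c {w} → w ∈ e → C w ≡ (C [ v ↦ c ]) w
  away c w∈e = sym (updateAt-minimal _ v C λ { refl → v∉e w∈e })

extend-at-low-degree : ∀ E (L : Fin m → List ℕ) v C → Unique (L v) → degree v E < length (L v) →
                       UniqueMaxOn C (map (_- v) E) → ChosenFrom L C →
                       ∃[ C′ ] UniqueMaxOn C′ E × ChosenFrom L C′
extend-at-low-degree E L v C uniq low um C∈L with forbidden-colours C v E um
... | F , |F| , F-free with ∃-∉ uniq (subst (_< length (L v)) (sym |F|) low)
... | c , c∈Lv , c∉F = C [ v ↦ c ] , F-free c c∉F , ↦-chosen C∈L c∈Lv

top-colour-at : ∀ (C : Fin m → ℕ) v M E → (∀ {w} → w ∈ ⋃ E → w ≢ v → C w < M) →
                UniqueMaxOn C (avoiding v E) → UniqueMaxOn (C [ v ↦ M ]) E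
top-colour-at C v M E below um = filter⁻ (v ∈?_) through-v avoiding-v
  where
  through-v : UniqueMaxOn (C [ v ↦ M ]) (filter (v ∈?_) E)
  through-v = All.tabulate λ e∈ _ → let e∈E , v∈e = ∈-filter⁻ (v ∈?_) {xs = E} e∈ in
    UniqueMaxIn-at v∈e λ w∈e w≢v →
      subst₂ _<_ (sym (updateAt-minimal _ v C w≢v)) (sym (updateAt-updates v C))
        (below (p⊆⋃ {ps = E} e∈E w∈e) w≢v)

  avoiding-v : UniqueMaxOn (C [ v ↦ M ]) (avoiding v E)
  avoiding-v = All.tabulate λ e∈ e≢∅ →
    let _ , v∉e = ∈-filter⁻ (¬? ∘ (v ∈?_)) {xs = E} e∈ in
    UniqueMaxIn-cong (λ w∈e → sym (updateAt-minimal _ v C λ { refl → v∉e w∈e }))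
                     (All.lookup um e∈ e≢∅)

edge-budget : ∀ s d k → 1 ≤ s → s ≤ d → 2 * (d + k) ≤ s * (s ∸ 1) →
              1 ≤ s ∸ 1 × 2 * k ≤ (s ∸ 1) * (s ∸ 1 ∸ 1)
edge-budget 0             d k () _ _
edge-budget 1             d k _  1≤d budget =
  contradiction (≤-trans (*-monoʳ-≤ 2 (≤-trans 1≤d (m≤m+n d k))) budget) λ ()
edge-budget (suc (suc u)) d k _  s≤d budget =
  s≤s z≤n , +-cancelˡ-≤ (2 * d) (2 * k) (suc u * u) (begin
    2 * d + 2 * k         ≡⟨ *-distribˡ-+ 2 d k ⟨
    2 * (d + k)           ≤⟨ budget ⟩
    suc (suc u) * suc u   ≡⟨ expand u ⟩
    2 * suc u + suc u * u ≤⟨ +-monoˡ-≤ (suc u * u) (*-monoʳ-≤ 2 (≤-trans (n≤1+n (suc u)) s≤d)) ⟩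
    2 * d + suc u * u     ∎)
  where
  open ≤-Reasoning
  expand : ∀ u → suc (suc u) * suc u ≡ 2 * suc u + suc u * u
  expand = solve-∀

⋃-minus-⊂ : ∀ {v : Fin m} E → v ∈ ⋃ E → ⋃ (map (_- v) E) ⊂ ⋃ E
⋃-minus-⊂ {v = v} E v∈⋃E = ⋃-⊂ {ps = E} v∈⋃E (map⁺ (All.tabulate {xs = E} λ {e} e∈E →
  p⊆⋃ e∈E ∘ p─q⊆p e ⁅ v ⁆ , x∉p-x v e))

⋃-avoiding-⊂ : ∀ {v : Fin m} E → v ∈ ⋃ E → ⋃ (avoiding v E) ⊂ ⋃ E
⋃-avoiding-⊂ {v = v} E v∈⋃E = ⋃-⊂ {ps = E} v∈⋃E (All.tabulate λ e∈ →
  let e∈E , v∉e = ∈-filter⁻ (¬? ∘ (v ∈?_)) {xs = E} e∈ in p⊆⋃ e∈E , v∉e)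

without-DistinctOfLength≥ : ∀ {s} {L : Fin m → List ℕ} M → DistinctOfLength≥ s L →
                            DistinctOfLength≥ (s ∸ 1) (without M ∘ L)
without-DistinctOfLength≥ M lists w = let uniq , long = lists w in
  Unique.filter⁺ _ uniq , ∸-monoˡ-≤ 1 (≤-trans long (length-without M uniq))

um-list-colouring : ∀ s (E : List (Subset m)) L → Acc _<_ ∣ ⋃ E ∣ →
                    1 ≤ s → 2 * length E ≤ s * (s ∸ 1) → DistinctOfLength≥ s L →
                    ∃[ C ] UniqueMaxOn C E × ChosenFrom L C
um-list-colouring s E L (acc smaller) 1≤s budget lists with nonempty? (⋃ E)
... | no ⋃E≡∅ =
  top ∘ L ,
  All.tabulate (λ e∈E (w , w∈e) → contradiction (w , p⊆⋃ e∈E w∈e) ⋃E≡∅) ,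
  λ w → top-∈ (≤-trans 1≤s (proj₂ (lists w)))
... | yes ⋃E≢∅ with maximiser (top ∘ L) (⋃ E) ⋃E≢∅
... | v , v∈⋃E , v-top with degree v E <? s
...   | yes low =
  let C , um , C∈L = um-list-colouring s (map (_- v) E) L
                       (smaller (p⊂q⇒∣p∣<∣q∣ (⋃-minus-⊂ E v∈⋃E))) 1≤s
                       (subst (λ k → 2 * k ≤ _) (sym (length-map (_- v) E)) budget) lists
  in extend-at-low-degree E L v C (proj₁ (lists v)) (<-≤-trans low (proj₂ (lists v))) um C∈L
...   | no high =
  let C , um , C∈L′ = um-list-colouring (s ∸ 1) (avoiding v E) (without M ∘ L)
                        (smaller (p⊂q⇒∣p∣<∣q∣ (⋃-avoiding-⊂ E v∈⋃E)))
                        (proj₁ budget′) (proj₂ budget′) (without-DistinctOfLength≥ M lists)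
      C∈L : ChosenFrom L C
      C∈L w = proj₁ (∈-without⁻ {xs = L w} (C∈L′ w))
      below : ∀ {w} → w ∈ ⋃ E → w ≢ v → C w < M
      below {w} w∈⋃E _ = ≤∧≢⇒< (≤-trans (≤-top (C∈L w)) (v-top w∈⋃E))
                                (proj₂ (∈-without⁻ {xs = L w} (C∈L′ w)))
  in C [ v ↦ M ] , top-colour-at C v M E below um ,
     ↦-chosen C∈L (top-∈ (≤-trans 1≤s (proj₂ (lists v))))
  where
  M = top (L v)

  budget′ : 1 ≤ s ∸ 1 × 2 * length (avoiding v E) ≤ (s ∸ 1) * (s ∸ 1 ∸ 1)
  budget′ = edge-budget s (degree v E) (length (avoiding v E)) 1≤s (≮⇒≥ high)
              (subst (λ k → 2 * k ≤ _) (sym (length-filter-¬ (v ∈?_) E)) budget)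

mainTheorem13 : (H : Hypergraph) (s : ℕ) → IsS H s → ChUmAtMost H s
mainTheorem13 H s (1≤s , budget , _) = s , ≤-refl , λ L assignment →
  let lists : DistinctOfLength≥ s L
      lists w = proj₁ (assignment w) , proj₂ (proj₂ (assignment w))
      C , um , C∈L = um-list-colouring s (edges H) L (<-wellFounded _) 1≤s budget lists
      positive : ∀ w → 1 ≤ C w
      positive w = All.lookup (proj₁ (proj₂ (assignment w))) (C∈L w)
  in C , (positive , All.zipWith (λ (um , e≢∅) → um e≢∅) (um , nonempty H)) , C∈L
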